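{- Let $m\in A=\mathbb{F}_q[T]$ be nonzero and let $u\in A$. Assume that if $\deg(u)=0$ or $\deg(u)=1$, then $q>2$. Then $C_m(u)\neq 0$ if and only if $u\neq 0$.
   Context: $A=\mathbb{F}_q[T]$, $k=\mathbb{F}_q(T)$. The Carlitz module is the $\mathbb{F}_q$-algebra homomorphism $a\mapsto C_a$ from $A$ to the twisted polynomial ring $k\langle\tau\rangle$ ($\tau(x)=x^q$) with $C_T=T+\tau$; so $C_T(x)=Tx+x^q$ and $C_a(x)\in A[x]$, with $C_{ab}(x)=C_a(C_b(x))$ and $C_{a+b}=C_a+C_b$. Convention: $\deg(0)=-\infty$. -}

module Defs where

open import Level using (Level) renaming (suc to lsuc)
open import Data.Nat using (ℕ; zero; suc; _<_)
open import Data.List using (List; []; _∷_; length; map)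
open import Data.List.Membership.Propositional using (_∈_)
open import Data.List.Relation.Unary.Unique.Propositional using (Unique)
open import Data.List.Relation.Unary.All using (All)
open import Data.Product using (Σ; _×_)
open import Relation.Nullary using (¬_; Dec)
open import Relation.Binary.PropositionalEquality using (_≡_)
open import Algebra.Structures using (IsCommutativeRing)

record FiniteField (c : Level) : Set (lsuc c) where
  infixl 6 _+_
  infixl 7 _*_
  field
    Carrier : Set c
    _+_ _*_ : Carrier → Carrier → Carrier
    -_      : Carrier → Carrier
    0# 1#   : Carrier
    isCommutativeRing : IsCommutativeRing _≡_ _+_ _*_ -_ 0# 1#
    0≢1     : ¬ (0# ≡ 1#)
    inverse : ∀ x → ¬ (x ≡ 0#) → Σ Carrier (λ y → x * y ≡ 1#)
    _≟_     : (x y : Carrier) → Dec (x ≡ y)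
    elements : List Carrier
    elements-unique   : Unique elements
    elements-complete : ∀ x → x ∈ elements

  card : ℕ
  card = length elements

module Poly {c : Level} (F : FiniteField c) where
  open FiniteField F

  -- Elements of A = F_q[T]: coefficient lists, constant term first
  -- (trailing zeros allowed).
  A : Set c
  A = List Carrier

  coeff : A → ℕ → Carrier
  coeff []      _       = 0#
  coeff (a ∷ p) zero    = a
  coeff (a ∷ p) (suc i) = coeff p i

  IsZero : A → Set c
  IsZero p = All (_≡ 0#) p

  HasDeg : A → ℕ → Set c
  HasDeg p d = (¬ (coeff p d ≡ 0#)) × (∀ i → d < i → coeff p i ≡ 0#)

  infixl 6 _⊕_
  infixl 7 _⊗_ _·_

  _⊕_ : A → A → A
  []      ⊕ q       = q
  (a ∷ p) ⊕ []      = a ∷ p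
  (a ∷ p) ⊕ (b ∷ q) = (a + b) ∷ (p ⊕ q)

  _·_ : Carrier → A → A
  a · p = map (a *_) p

  _⊗_ : A → A → A
  []      ⊗ q = []
  (a ∷ p) ⊗ q = (a · q) ⊕ (0# ∷ (p ⊗ q))

  pow : A → ℕ → A
  pow p zero    = 1# ∷ []
  pow p (suc n) = p ⊗ pow p n

  Tpoly : A
  Tpoly = 0# ∷ 1# ∷ []

  CT : A → A
  CT x = Tpoly ⊗ x ⊕ pow x card

  -- C_m(x) for m = m₀ + T m' : C_m = m₀ + C_T ∘ C_{m'}
  -- (the unique F_q-algebra homomorphism with C_T = T + τ, i.e. C_m = Σ mᵢ C_T^i).
  carlitz : A → A → A
  carlitz []       x = []
  carlitz (a ∷ m)  x = a · x ⊕ CT (carlitz m x)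

module Submission where

-- C_m(0) = 0 and C_0(u) = 0 hold coefficientwise, which gives the
-- implication "C_m(u) ≠ 0 ⇒ u ≠ 0".  For the converse we track degrees: if
-- deg y = e, then C_T(y) = T·y + y^q has the two candidate top terms of degrees
-- e + 1 and q·e, which differ unless q = 2 and e = 1.  Outside that exceptional
-- case deg C_T(y) = max(e + 1, q·e) > e.  Writing m = a + T·m', we have
-- C_m(u) = a·u + C_T(C_{m'}(u)); by induction on m, either m' = 0 and
-- C_m(u) = a·u with a ≠ 0, or deg C_{m'}(u) ≥ deg u and the C_T-term strictly
-- dominates a·u.  Either way deg C_m(u) ≥ deg u, so C_m(u) ≠ 0.

open import Defs
open import Level using (Level)
open import Data.Nat as ℕ using (ℕ; zero; suc; _<_; _≤_; z≤n; s≤s)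
open import Data.Nat.Properties
  using (≤-refl; ≤-trans; <⇒≤; ≤-<-trans; <-≤-trans; <-trans; <-cmp; n<1+n; m≤n+m;
         +-comm; +-cancelˡ-≡; m*n≡1⇒m≡1; m*n≡1⇒n≡1)
open import Data.Sum using (_⊎_; inj₁; inj₂; map₂)
open import Data.Product using (∃-syntax; _×_; _,_; proj₂)
open import Data.List using ([]; _∷_; length)
open import Data.List.Relation.Unary.All using ([]; _∷_; all?)
open import Data.Empty using (⊥; ⊥-elim)
open import Relation.Nullary using (¬_; yes; no)
open import Relation.Binary.PropositionalEquality
  using (_≡_; _≢_; refl; sym; trans; cong; cong₂; module ≡-Reasoning)
open import Relation.Binary.Definitions using (tri<; tri≈; tri>)
open import Algebra.Structures using (IsCommutativeRing)

-- q·e = e + 1 forces q = 2 and e = 1, which is exactly the excluded case.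
q*e≢1+e : ∀ q e → 2 < q ⊎ 2 ≤ e → q ℕ.* e ≢ suc e
q*e≢1+e zero    e _     ()
q*e≢1+e (suc p) e bound eq = excluded (m*n≡1⇒m≡1 p e p*e≡1) (m*n≡1⇒n≡1 p e p*e≡1) bound
  where
  p*e≡1 : p ℕ.* e ≡ 1
  p*e≡1 = +-cancelˡ-≡ e (p ℕ.* e) 1 (trans eq (+-comm 1 e))

  excluded : p ≡ 1 → e ≡ 1 → 2 < suc p ⊎ 2 ≤ e → ⊥
  excluded refl refl (inj₁ (s≤s (s≤s ())))
  excluded refl refl (inj₂ (s≤s ()))

module CarlitzDegree {c : Level} (F : FiniteField c) where
  open FiniteField F
  open Poly F
  open IsCommutativeRing isCommutativeRing
    using (+-identityˡ; +-identityʳ; zeroˡ; zeroʳ; *-identityˡ; *-assoc; *-comm)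

  *-nonzero : ∀ {x y} → x ≢ 0# → y ≢ 0# → x * y ≢ 0#
  *-nonzero {x} {y} x≢0 y≢0 xy≡0 with inverse x x≢0
  ... | x⁻¹ , xx⁻¹≡1 = y≢0 (begin
      y                ≡⟨ sym (*-identityˡ y) ⟩
      1# * y           ≡⟨ cong (_* y) (trans (sym xx⁻¹≡1) (*-comm x x⁻¹)) ⟩
      (x⁻¹ * x) * y    ≡⟨ *-assoc x⁻¹ x y ⟩
      x⁻¹ * (x * y)    ≡⟨ cong (x⁻¹ *_) xy≡0 ⟩
      x⁻¹ * 0#         ≡⟨ zeroʳ x⁻¹ ⟩
      0#               ∎)
    where open ≡-Reasoning

  +-vanishes : ∀ {x y} → x ≡ 0# → y ≡ 0# → x + y ≡ 0#
  +-vanishes refl refl = +-identityˡ 0#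

  *-vanishesʳ : ∀ x {y} → y ≡ 0# → x * y ≡ 0#
  *-vanishesʳ x refl = zeroʳ x

  card-positive : ∃[ k ] card ≡ suc k
  card-positive with elements | elements-complete 0#
  ... | _ ∷ xs | _ = length xs , refl

  coeff-⊕ : ∀ p r i → coeff (p ⊕ r) i ≡ coeff p i + coeff r i
  coeff-⊕ []      r       i       = sym (+-identityˡ _)
  coeff-⊕ (a ∷ p) []      i       = sym (+-identityʳ _)
  coeff-⊕ (a ∷ p) (b ∷ r) zero    = refl
  coeff-⊕ (a ∷ p) (b ∷ r) (suc i) = coeff-⊕ p r i

  coeff-· : ∀ a p i → coeff (a · p) i ≡ a * coeff p i
  coeff-· a []      i       = sym (zeroʳ a)
  coeff-· a (x ∷ p) zero    = refl
  coeff-· a (x ∷ p) (suc i) = coeff-· a p i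

  coeff-⊗ : ∀ x p r i → coeff ((x ∷ p) ⊗ r) i ≡ x * coeff r i + coeff (0# ∷ (p ⊗ r)) i
  coeff-⊗ x p r i = trans (coeff-⊕ (x · r) (0# ∷ (p ⊗ r)) i) (cong (_+ _) (coeff-· x r i))

  Vanishes : A → Set c
  Vanishes p = ∀ i → coeff p i ≡ 0#

  IsZero⇒Vanishes : ∀ p → IsZero p → Vanishes p
  IsZero⇒Vanishes []      _          i       = refl
  IsZero⇒Vanishes (x ∷ p) (x≡0 ∷ _)  zero    = x≡0
  IsZero⇒Vanishes (x ∷ p) (_ ∷ p≡0)  (suc i) = IsZero⇒Vanishes p p≡0 i

  Vanishes⇒IsZero : ∀ p → Vanishes p → IsZero p
  Vanishes⇒IsZero []      _   = []
  Vanishes⇒IsZero (x ∷ p) p≡0 = p≡0 zero ∷ Vanishes⇒IsZero p (λ i → p≡0 (suc i))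

  shift-vanishes : ∀ {p} → Vanishes p → Vanishes (0# ∷ p)
  shift-vanishes p≡0 zero    = refl
  shift-vanishes p≡0 (suc i) = p≡0 i

  ⊕-vanishes : ∀ p r → Vanishes p → Vanishes r → Vanishes (p ⊕ r)
  ⊕-vanishes p r p≡0 r≡0 i = trans (coeff-⊕ p r i) (+-vanishes (p≡0 i) (r≡0 i))

  ⊗-vanishesˡ : ∀ p r → Vanishes p → Vanishes (p ⊗ r)
  ⊗-vanishesˡ []      r _   i = refl
  ⊗-vanishesˡ (x ∷ p) r p≡0 i = trans (coeff-⊗ x p r i)
    (+-vanishes (trans (cong (_* _) (p≡0 zero)) (zeroˡ _))
                (shift-vanishes (⊗-vanishesˡ p r (λ j → p≡0 (suc j))) i))

  ⊗-vanishesʳ : ∀ p r → Vanishes r → Vanishes (p ⊗ r)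
  ⊗-vanishesʳ []      r _   i = refl
  ⊗-vanishesʳ (x ∷ p) r r≡0 i = trans (coeff-⊗ x p r i)
    (+-vanishes (*-vanishesʳ x (r≡0 i)) (shift-vanishes (⊗-vanishesʳ p r r≡0) i))

  -- C_T(0) = 0; this uses q ≥ 1 (since y^0 = 1).
  CT-vanishes : ∀ y → Vanishes y → Vanishes (CT y)
  CT-vanishes y y≡0 with card | card-positive
  ... | .(suc k) | k , refl =
    ⊕-vanishes (Tpoly ⊗ y) (pow y (suc k)) (⊗-vanishesʳ Tpoly y y≡0) (⊗-vanishesˡ y (pow y k) y≡0)

  carlitz-vanishesʳ : ∀ m u → Vanishes u → Vanishes (carlitz m u)
  carlitz-vanishesʳ []      u u≡0 i = refl
  carlitz-vanishesʳ (a ∷ m) u u≡0 = ⊕-vanishes (a · u) (CT (carlitz m u))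
    (λ i → trans (coeff-· a u i) (*-vanishesʳ a (u≡0 i)))
    (CT-vanishes (carlitz m u) (carlitz-vanishesʳ m u u≡0))

  carlitz-vanishesˡ : ∀ m u → IsZero m → Vanishes (carlitz m u)
  carlitz-vanishesˡ []      u _           i = refl
  carlitz-vanishesˡ (a ∷ m) u (a≡0 ∷ m≡0) = ⊕-vanishes (a · u) (CT (carlitz m u))
    (λ i → trans (coeff-· a u i) (trans (cong (_* _) a≡0) (zeroˡ _)))
    (CT-vanishes (carlitz m u) (carlitz-vanishesˡ m u m≡0))

  DegAtMost : A → ℕ → Set c
  DegAtMost p d = ∀ i → d < i → coeff p i ≡ 0#

  DegBelow : A → ℕ → Set c
  DegBelow r d = ∀ i → d ≤ i → coeff r i ≡ 0#

  degAtMost-below : ∀ r {e d} → DegAtMost r e → e < d → DegBelow r d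
  degAtMost-below r r≤e e<d i d≤i = r≤e i (<-≤-trans e<d d≤i)

  HasDeg⇒nonzero : ∀ p {d} → HasDeg p d → ¬ IsZero p
  HasDeg⇒nonzero p {d} (top≢0 , _) p≡0 = top≢0 (IsZero⇒Vanishes p p≡0 d)

  degree-exists : ∀ u → ¬ IsZero u → ∃[ d ] HasDeg u d
  degree-exists []      u≢0 = ⊥-elim (u≢0 [])
  degree-exists (x ∷ u) xu≢0 with all? (_≟ 0#) u
  ... | yes u≡0 = 0 , (λ x≡0 → xu≢0 (x≡0 ∷ u≡0)) ,
                  λ { zero () ; (suc i) _ → IsZero⇒Vanishes u u≡0 i }
  ... | no u≢0 with degree-exists u u≢0
  ... | d , top≢0 , u≤d = suc d , top≢0 , λ { zero () ; (suc i) (s≤s d<i) → u≤d i d<i }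

  HasDeg-transfer : ∀ p r {d} → (∀ i → d ≤ i → coeff p i ≡ coeff r i) → HasDeg p d → HasDeg r d
  HasDeg-transfer p r {d} same (top≢0 , p≤d) =
    (λ top≡0 → top≢0 (trans (same d ≤-refl) top≡0)) ,
    (λ i d<i → trans (sym (same i (<⇒≤ d<i))) (p≤d i d<i))

  deg-⊕ʳ : ∀ p r {d} → HasDeg p d → DegBelow r d → HasDeg (p ⊕ r) d
  deg-⊕ʳ p r hp r<d = HasDeg-transfer p (p ⊕ r)
    (λ i d≤i → sym (trans (coeff-⊕ p r i) (trans (cong (_ +_) (r<d i d≤i)) (+-identityʳ _)))) hp

  deg-⊕ˡ : ∀ p r {d} → DegBelow p d → HasDeg r d → HasDeg (p ⊕ r) d
  deg-⊕ˡ p r p<d hr = HasDeg-transfer r (p ⊕ r)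
    (λ i d≤i → sym (trans (coeff-⊕ p r i) (trans (cong (_+ _) (p<d i d≤i)) (+-identityˡ _)))) hr

  ·-degAtMost : ∀ a p {d} → DegAtMost p d → DegAtMost (a · p) d
  ·-degAtMost a p p≤d i d<i = trans (coeff-· a p i) (*-vanishesʳ a (p≤d i d<i))

  deg-· : ∀ a p {d} → a ≢ 0# → HasDeg p d → HasDeg (a · p) d
  deg-· a p {d} a≢0 (top≢0 , p≤d) =
    (λ top≡0 → *-nonzero a≢0 top≢0 (trans (sym (coeff-· a p d)) top≡0)) , ·-degAtMost a p p≤d

  tail-degAtMost : ∀ x p {d} → DegAtMost (x ∷ p) (suc d) → DegAtMost p d
  tail-degAtMost x p xp≤d i d<i = xp≤d (suc i) (s≤s d<i)

  tail-vanishes : ∀ x p → DegAtMost (x ∷ p) 0 → Vanishes p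
  tail-vanishes x p xp≤0 i = xp≤0 (suc i) (s≤s z≤n)

  ⊗-degAtMost : ∀ p r d e → DegAtMost p d → DegAtMost r e → DegAtMost (p ⊗ r) (d ℕ.+ e)
  ⊗-degAtMost []      r d       e _    _   i       _ = refl
  ⊗-degAtMost (x ∷ p) r zero    e xp≤0 r≤e i       e<i = trans (coeff-⊗ x p r i)
    (+-vanishes (*-vanishesʳ x (r≤e i e<i))
                (shift-vanishes (⊗-vanishesˡ p r (tail-vanishes x p xp≤0)) i))
  ⊗-degAtMost (x ∷ p) r (suc d) e xp≤d r≤e zero    ()
  ⊗-degAtMost (x ∷ p) r (suc d) e xp≤d r≤e (suc i) (s≤s d+e<i) = trans (coeff-⊗ x p r (suc i))
    (+-vanishes (*-vanishesʳ x (r≤e (suc i) (s≤s (≤-trans (m≤n+m e d) (<⇒≤ d+e<i)))))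
                (⊗-degAtMost p r d e (tail-degAtMost x p xp≤d) r≤e i d+e<i))

  ⊗-top : ∀ p r d e → DegAtMost p d → DegAtMost r e →
          coeff (p ⊗ r) (d ℕ.+ e) ≡ coeff p d * coeff r e
  ⊗-top []      r d       e _    _   = sym (zeroˡ _)
  ⊗-top (x ∷ p) r zero    e xp≤0 r≤e = trans (coeff-⊗ x p r e)
    (trans (cong (_ +_) (shift-vanishes (⊗-vanishesˡ p r (tail-vanishes x p xp≤0)) e))
           (+-identityʳ _))
  ⊗-top (x ∷ p) r (suc d) e xp≤d r≤e = trans (coeff-⊗ x p r (suc (d ℕ.+ e)))
    (trans (cong₂ _+_ (*-vanishesʳ x (r≤e _ (s≤s (m≤n+m e d))))
                      (⊗-top p r d e (tail-degAtMost x p xp≤d) r≤e))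
           (+-identityˡ _))

  deg-⊗ : ∀ p r {d e} → HasDeg p d → HasDeg r e → HasDeg (p ⊗ r) (d ℕ.+ e)
  deg-⊗ p r {d} {e} (p-top≢0 , p≤d) (r-top≢0 , r≤e) =
    (λ top≡0 → *-nonzero p-top≢0 r-top≢0 (trans (sym (⊗-top p r d e p≤d r≤e)) top≡0)) ,
    ⊗-degAtMost p r d e p≤d r≤e

  deg-pow : ∀ y {e} → HasDeg y e → ∀ n → HasDeg (pow y n) (n ℕ.* e)
  deg-pow y _  zero    = (λ 1≡0 → 0≢1 (sym 1≡0)) , λ { zero () ; (suc i) _ → refl }
  deg-pow y hy (suc n) = deg-⊗ y (pow y n) hy (deg-pow y hy n)

  deg-T : HasDeg Tpoly 1
  deg-T = (λ 1≡0 → 0≢1 (sym 1≡0)) ,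
          λ { zero () ; (suc zero) (s≤s ()) ; (suc (suc i)) _ → refl }

  -- The degrees excluded by the hypothesis of the corollary: q = 2 and d ≤ 1.
  NonExceptional : ℕ → Set
  NonExceptional d = 2 < card ⊎ 2 ≤ d

  -- C_T raises the degree: deg C_T(y) = max(e + 1, q·e) > e, since the top terms
  -- of T·y and y^q have different degrees and so cannot cancel.
  deg-CT : ∀ y {e} → HasDeg y e → NonExceptional e → ∃[ e' ] e < e' × HasDeg (CT y) e'
  deg-CT y {e} hy ok with <-cmp (suc e) (card ℕ.* e)
  ... | tri< e+1<qe _ _ = card ℕ.* e , <-trans (n<1+n e) e+1<qe ,
        deg-⊕ˡ (Tpoly ⊗ y) (pow y card)
               (degAtMost-below (Tpoly ⊗ y) (proj₂ (deg-⊗ Tpoly y deg-T hy)) e+1<qe)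
               (deg-pow y hy card)
  ... | tri≈ _ e+1≡qe _ = ⊥-elim (q*e≢1+e card e ok (sym e+1≡qe))
  ... | tri> _ _ qe<e+1 = suc e , n<1+n e ,
        deg-⊕ʳ (Tpoly ⊗ y) (pow y card) (deg-⊗ Tpoly y deg-T hy)
               (degAtMost-below (pow y card) (proj₂ (deg-pow y hy card)) qe<e+1)

  -- Induction on
  -- m = a + T·m': either m' = 0 and C_m(u) = a·u with a ≠ 0, or C_T(C_{m'}(u))
  -- has degree above deg C_{m'}(u) ≥ d and dominates a·u.
  deg-carlitz : ∀ m u {d} → ¬ IsZero m → HasDeg u d → NonExceptional d →
                ∃[ D ] d ≤ D × HasDeg (carlitz m u) D
  deg-carlitz []      u m≢0 = ⊥-elim (m≢0 [])
  deg-carlitz (a ∷ m) u {d} am≢0 hu ok with all? (_≟ 0#) m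
  ... | yes m≡0 = d , ≤-refl ,
        deg-⊕ʳ (a · u) (CT (carlitz m u)) (deg-· a u (λ a≡0 → am≢0 (a≡0 ∷ m≡0)) hu)
               (λ i _ → CT-vanishes (carlitz m u) (carlitz-vanishesˡ m u m≡0) i)
  ... | no m≢0 with deg-carlitz m u m≢0 hu ok
  ... | D , d≤D , hD with deg-CT (carlitz m u) hD (map₂ (λ 2≤d → ≤-trans 2≤d d≤D) ok)
  ... | E , D<E , hE = E , ≤-trans d≤D (<⇒≤ D<E) ,
        deg-⊕ˡ (a · u) (CT (carlitz m u))
               (degAtMost-below (a · u) (·-degAtMost a u (proj₂ hu)) (≤-<-trans d≤D D<E)) hE

corollary2p6 : ∀ {c : Level} (F : FiniteField c) (m u : Poly.A F) →
    ¬ Poly.IsZero F m →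
    ((Poly.HasDeg F u 0 ⊎ Poly.HasDeg F u 1) → 2 < FiniteField.card F) →
    (¬ Poly.IsZero F (Poly.carlitz F m u) → ¬ Poly.IsZero F u) ×
      (¬ Poly.IsZero F u → ¬ Poly.IsZero F (Poly.carlitz F m u))
corollary2p6 F m u m≢0 low-degree⇒q>2 = Cu≢0⇒u≢0 , u≢0⇒Cu≢0
  where
  open Poly F
  open CarlitzDegree F

  Cu≢0⇒u≢0 : ¬ IsZero (carlitz m u) → ¬ IsZero u
  Cu≢0⇒u≢0 Cu≢0 u≡0 =
    Cu≢0 (Vanishes⇒IsZero (carlitz m u) (carlitz-vanishesʳ m u (IsZero⇒Vanishes u u≡0)))

  nonExceptional : ∀ d → HasDeg u d → NonExceptional d
  nonExceptional zero          hu = inj₁ (low-degree⇒q>2 (inj₁ hu))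
  nonExceptional (suc zero)    hu = inj₁ (low-degree⇒q>2 (inj₂ hu))
  nonExceptional (suc (suc d)) _  = inj₂ (s≤s (s≤s z≤n))

  u≢0⇒Cu≢0 : ¬ IsZero u → ¬ IsZero (carlitz m u)
  u≢0⇒Cu≢0 u≢0 with degree-exists u u≢0
  ... | d , hu with deg-carlitz m u m≢0 hu (nonExceptional d hu)
  ... | _ , _ , hC = HasDeg⇒nonzero (carlitz m u) hC
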